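{- If $n\ge 3$ and $\varphi(\vec{x},\vec{y})$ is a generalized $P$-encoding on $n$ input variables, then $\varphi$ has at least $\min(2n,3n-6)$ clauses.
   Context: A CNF formula is a set of clauses (sets of literals). Let $\vec{x}=(x_1,\dots,x_n)$ be input variables and $\vec{y}$ a finite set of auxiliary variables. A CNF $\varphi(\vec{x},\vec{y})$ is a generalized $P$-encoding on $n$ input variables if (a) $\varphi\wedge x_i$ is satisfiable for each $i\in[n]$, and (b) $\varphi\models\overline{x_i}\vee\overline{x_j}$ for all distinct $i,j\in[n]$. -}

module Defs where

open import Data.Nat using (ℕ; _+_)
open import Data.Bool using (Bool; true; false)
open import Data.Fin using (Fin; _↑ˡ_)
open import Data.Fin.Subset using (Subset; _∈_)
open import Data.List using (List)
open import Data.List.Relation.Unary.All using (All)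
open import Data.Product using (Σ; _×_; ∃)
open import Data.Sum using (_⊎_)
open import Relation.Binary.PropositionalEquality using (_≡_)
open import Relation.Nullary using (¬_)

-- Variables of a formula over n input variables and m auxiliary variables:
-- Fin (n + m); the input variable x_i is  i ↑ˡ m , the auxiliary ones are  n ↑ʳ j.
Var : ℕ → ℕ → Set
Var n m = Fin (n + m)

record Clause (k : ℕ) : Set where
  constructor clause
  field
    pos : Subset k
    neg : Subset k
open Clause public

-- A CNF is a set of clauses: a duplicate-free list (duplicate-freeness is
-- imposed in the statement), so its number of clauses is its length.
CNF : ℕ → Set
CNF k = List (Clause k)

Assignment : ℕ → Set
Assignment k = Fin k → Bool

SatClause : ∀ {k} → Assignment k → Clause k → Set
SatClause {k} a C =
  ∃ λ (i : Fin k) → (i ∈ pos C × a i ≡ true) ⊎ (i ∈ neg C × a i ≡ false)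

Sat : ∀ {k} → Assignment k → CNF k → Set
Sat a φ = All (SatClause a) φ

inp : ∀ {n} m → Fin n → Var n m
inp m i = i ↑ˡ m

record IsGenPEncoding (n m : ℕ) (φ : CNF (n + m)) : Set where
  field
    sat-xi : ∀ (i : Fin n) → ∃ λ (a : Assignment (n + m)) →
               Sat a φ × a (inp m i) ≡ true
    amo    : ∀ (i j : Fin n) → ¬ i ≡ j → ∀ (a : Assignment (n + m)) →
               Sat a φ → (a (inp m i) ≡ false ⊎ a (inp m j) ≡ false)

-- Replace the input variables x_i by arbitrary literals l_i and induct on the number of
-- clauses. Making l_i true in a model of l_j (j ≠ i) falsifies φ, and only at clauses
-- containing ¬l_i; so every ¬l_i occurs. If ¬l_i occurs exactly once, in a clause P that the
-- model of l_i satisfies through a literal m, then dropping P and substituting "l_i ⇔ m" for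
-- the variable of l_i gives an encoding, with l_i replaced by m, that has one clause fewer.
-- Otherwise, setting l_i false deletes the clauses containing ¬l_i and leaves an encoding of
-- the other n - 1 literals. This saves three clauses if ¬l_i occurs three times, or twice
-- with one clause also containing some ¬l_j, which then occurs only once in the rest. In the
-- remaining case all ¬l_i occur at least twice and in pairwise different clauses, so there
-- are 2n clauses; for n = 3 a direct count gives three.
module Submission where

open import Defs
open import Data.Nat using (ℕ; _+_; _≤_; _*_; _∸_; _⊓_; zero; suc; z≤n; s≤s; _<_; _≟_; _≤?_)
open import Data.List.Relation.Unary.Unique.Propositional using (Unique)

open import Data.Nat.Properties
open import Algebra.Properties.CommutativeMonoid.Sum +-0-commutativeMonoid
  using (sum-syntax; sum-cong-≗; sum-replicate-zero; ∑-distrib-+)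
open import Data.Bool as Bool using (Bool; true; false; not; _∨_; _xor_; T; T?)
open import Data.Bool.Properties using (¬-not; not-¬; not-injective; T-∨; T-≡)
open import Data.Empty using (⊥; ⊥-elim)
open import Data.Fin as Fin using (Fin; zero; suc; punchIn; punchOut)
open import Data.Fin.Properties as Finₚ using (any?; punchInᵢ≢i; punchIn-injective; punchIn-punchOut)
open import Data.List using (List; []; _∷_; [_]; map; filter; length)
open import Data.List.Properties using (length-map; length-++; filter-++; filter-notAll)
open import Data.List.Membership.Propositional using (_∈_)
open import Data.List.Membership.Propositional.Properties using (∈-filter⁻)
open import Data.List.Relation.Unary.All as All using (All; []; _∷_)
open import Data.List.Relation.Unary.All.Properties
  using (all-filter; filter⁺; filter⁻; map⁺; map⁻; ¬All⇒Any¬)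
open import Data.List.Relation.Unary.Any as Any using (Any; here; there)
open import Data.List.Relation.Unary.Any.Properties using () renaming (filter⁻ to Any-filter⁻)
open import Data.List.Relation.Binary.Sublist.Propositional.Properties
  using (filter-⊆; length-mono-≤) renaming (filter⁺ to filter-⊆⁺)
open import Data.Nat.Induction using (<-wellFounded)
open import Data.Product using (_×_; _,_; proj₁; proj₂; ∃; ∃₂)
open import Data.Sum using (_⊎_; inj₁; inj₂; [_,_]′)
open import Data.Vec as Vec using ()
open import Data.Vec.Properties using ([]=⇒lookup; lookup⇒[]=)
open import Data.Vec.Functional using (updateAt)
open import Data.Vec.Functional.Properties using (updateAt-updates; updateAt-minimal)
open import Function using (_∘_; const; _⇔_; mk⇔; Equivalence)
open import Induction.WellFounded using (Acc; acc)
open import Level using (Level)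
open import Relation.Binary.PropositionalEquality using (_≡_; _≢_; refl; sym; trans; cong; subst)
open import Relation.Nullary using (¬_; yes; no)
open import Relation.Unary using (Pred; Decidable; _∩_)
open import Relation.Unary.Properties using (∁?)

private
  variable
    ℓa ℓp ℓq : Level
    A B : Set ℓa
    k n : ℕ

bound : ℕ → ℕ
bound n = (2 * n) ⊓ (3 * n ∸ 6)

bound≤2* : ∀ n → bound n ≤ 2 * n
bound≤2* n = m⊓n≤m (2 * n) (3 * n ∸ 6)

m+n∸o≤m∸o+n : ∀ m n o → m + n ∸ o ≤ (m ∸ o) + n
m+n∸o≤m∸o+n m n o = m≤n+o⇒m∸n≤o (m + n) o (begin
  m + n                ≤⟨ +-monoˡ-≤ n (m≤n+m∸n m o) ⟩
  o + (m ∸ o) + n      ≡⟨ +-assoc o (m ∸ o) n ⟩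
  o + ((m ∸ o) + n)    ∎)
  where open ≤-Reasoning

bound-suc : ∀ n → bound (suc n) ≤ bound n + 3
bound-suc n = begin
  (2 * suc n) ⊓ (3 * suc n ∸ 6)
    ≤⟨ ⊓-mono-≤ (≤-reflexive (*-suc′ 2)) (∸-monoˡ-≤ 6 (≤-reflexive (*-suc′ 3))) ⟩
  (2 * n + 2) ⊓ (3 * n + 3 ∸ 6)
    ≤⟨ ⊓-mono-≤ (+-monoʳ-≤ (2 * n) (n≤1+n 2)) (m+n∸o≤m∸o+n (3 * n) 3 6) ⟩
  (2 * n + 3) ⊓ ((3 * n ∸ 6) + 3)
    ≡⟨ +-distribʳ-⊓ 3 (2 * n) (3 * n ∸ 6) ⟨
  bound n + 3
    ∎
  where
  open ≤-Reasoning
  *-suc′ : ∀ c → c * suc n ≡ c * n + c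
  *-suc′ c = trans (*-suc c n) (+-comm c (c * n))

module _ {P : Pred A ℓp} (P? : Decidable P) where

  length-filter-∁ : ∀ xs → length (filter (∁? P?) xs) + length (filter P? xs) ≡ length xs
  length-filter-∁ [] = refl
  length-filter-∁ (x ∷ xs) with P? x
  ... | yes _ = trans (+-suc _ _) (cong suc (length-filter-∁ xs))
  ... | no _  = cong suc (length-filter-∁ xs)

  length-filter-map : (f : B → A) {Q : Pred B ℓq} (Q? : Decidable Q) → (∀ {x} → P (f x) ⇔ Q x) →
                      ∀ xs → length (filter P? (map f xs)) ≡ length (filter Q? xs)
  length-filter-map f Q? P∘f⇔Q [] = refl
  length-filter-map f Q? P∘f⇔Q (x ∷ xs) with P? (f x) | Q? x
  ... | yes _ | yes _ = cong suc (length-filter-map f Q? P∘f⇔Q xs)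
  ... | no _  | no _  = length-filter-map f Q? P∘f⇔Q xs
  ... | yes p | no ¬q = ⊥-elim (¬q (Equivalence.to P∘f⇔Q p))
  ... | no ¬p | yes q = ⊥-elim (¬p (Equivalence.from P∘f⇔Q q))

  length-filter-filter-∁< : ∀ {Q : Pred A ℓq} (Q? : Decidable Q) {xs} → Any (P ∩ Q) xs →
                            length (filter P? (filter (∁? Q?) xs)) < length (filter P? xs)
  length-filter-filter-∁< Q? {x ∷ xs} (here (px , qx)) with Q? x | P? x
  ... | yes _  | yes _  =
    s≤s (length-mono-≤ (filter-⊆⁺ P? P? (λ { refl p → p }) (filter-⊆ (∁? Q?) xs)))
  ... | yes _  | no ¬px = ⊥-elim (¬px px)
  ... | no ¬qx | _      = ⊥-elim (¬qx qx)
  length-filter-filter-∁< Q? {x ∷ xs} (there pq) with Q? x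
  ... | yes _ with P? x
  ...   | yes _ = m≤n⇒m≤1+n (length-filter-filter-∁< Q? pq)
  ...   | no _  = length-filter-filter-∁< Q? pq
  length-filter-filter-∁< Q? {x ∷ xs} (there pq) | no _ with P? x
  ...   | yes _ = s≤s (length-filter-filter-∁< Q? pq)
  ...   | no _  = length-filter-filter-∁< Q? pq

Any⇒0<length : ∀ {P : Pred A ℓp} {xs} → Any P xs → 0 < length xs
Any⇒0<length (here _)  = s≤s z≤n
Any⇒0<length (there _) = s≤s z≤n

length≡1⇒singleton : ∀ (xs : List A) → length xs ≡ 1 → ∃ λ x → xs ≡ [ x ]
length≡1⇒singleton (x ∷ []) refl = x , refl

∑-filter-[x]≡0⊎∃ : ∀ {P : Fin n → Pred A ℓp} (P? : ∀ i → Decidable (P i)) x →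
                   (∑[ i < n ] length (filter (P? i) [ x ])) ≡ 0 ⊎ ∃ λ i → P i x
∑-filter-[x]≡0⊎∃ {n = zero} P? x = inj₁ refl
∑-filter-[x]≡0⊎∃ {n = suc n} P? x with P? zero x
... | yes p₀ = inj₂ (zero , p₀)
... | no _ with ∑-filter-[x]≡0⊎∃ (P? ∘ suc) x
...   | inj₁ ∑≡0     = inj₁ ∑≡0
...   | inj₂ (i , p) = inj₂ (suc i , p)

∑-filter-[x]≤1⊎overlap : ∀ {P : Fin n → Pred A ℓp} (P? : ∀ i → Decidable (P i)) x →
                         (∑[ i < n ] length (filter (P? i) [ x ])) ≤ 1 ⊎
                         ∃₂ λ i j → i ≢ j × P i x × P j x
∑-filter-[x]≤1⊎overlap {n = zero} P? x = inj₁ z≤n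
∑-filter-[x]≤1⊎overlap {n = suc n} P? x with P? zero x
... | yes p₀ with ∑-filter-[x]≡0⊎∃ (P? ∘ suc) x
...   | inj₁ ∑≡0     = inj₁ (≤-reflexive (cong suc ∑≡0))
...   | inj₂ (j , p) = inj₂ (zero , suc j , (λ ()) , p₀ , p)
∑-filter-[x]≤1⊎overlap {n = suc n} P? x | no _ with ∑-filter-[x]≤1⊎overlap (P? ∘ suc) x
...   | inj₁ ∑≤1                     = inj₁ ∑≤1
...   | inj₂ (i , j , i≢j , pᵢ , pⱼ) = inj₂ (suc i , suc j , i≢j ∘ Finₚ.suc-injective , pᵢ , pⱼ)

∑-length-filter≤length⊎overlap :
  ∀ {P : Fin n → Pred A ℓp} (P? : ∀ i → Decidable (P i)) xs →
  (∑[ i < n ] length (filter (P? i) xs)) ≤ length xs ⊎ ∃₂ λ i j → i ≢ j × Any (P i ∩ P j) xs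
∑-length-filter≤length⊎overlap {n = n} P? [] = inj₁ (≤-reflexive (sum-replicate-zero n))
∑-length-filter≤length⊎overlap {n = n} P? (x ∷ xs)
  with ∑-length-filter≤length⊎overlap P? xs | ∑-filter-[x]≤1⊎overlap P? x
... | inj₂ (i , j , i≢j , pq) | _                             = inj₂ (i , j , i≢j , there pq)
... | inj₁ _                  | inj₂ (i , j , i≢j , pᵢ , pⱼ) = inj₂ (i , j , i≢j , here (pᵢ , pⱼ))
... | inj₁ ∑xs≤length         | inj₁ ∑x≤1                    = inj₁ (begin
  ∑[ i < n ] length (filter (P? i) (x ∷ xs))    ≡⟨ sum-cong-≗ split ⟩
  ∑[ i < n ] (count-x i + count-xs i)           ≡⟨ ∑-distrib-+ count-x count-xs ⟩
  ∑[ i < n ] count-x i + ∑[ i < n ] count-xs i  ≤⟨ +-mono-≤ ∑x≤1 ∑xs≤length ⟩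
  suc (length xs)                               ∎)
  where
  open ≤-Reasoning
  count-x count-xs : Fin n → ℕ
  count-x i = length (filter (P? i) [ x ])
  count-xs i = length (filter (P? i) xs)
  split : ∀ i → length (filter (P? i) (x ∷ xs)) ≡ count-x i + count-xs i
  split i = trans (cong length (filter-++ (P? i) [ x ] xs)) (length-++ (filter (P? i) [ x ]))

*≤∑ : ∀ {c} (f : Fin n → ℕ) → (∀ i → c ≤ f i) → n * c ≤ ∑[ i < n ] f i
*≤∑ {n = zero}  f c≤f = z≤n
*≤∑ {n = suc n} f c≤f = +-mono-≤ (c≤f zero) (*≤∑ (f ∘ suc) (c≤f ∘ suc))

avoid-two : (i j : Fin (3 + n)) → ∃ λ t → t ≢ i × t ≢ j
avoid-two zero          zero          = suc zero , (λ ()) , (λ ())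
avoid-two zero          (suc zero)    = suc (suc zero) , (λ ()) , (λ ())
avoid-two zero          (suc (suc _)) = suc zero , (λ ()) , (λ ())
avoid-two (suc zero)    zero          = suc (suc zero) , (λ ()) , (λ ())
avoid-two (suc zero)    (suc _)       = zero , (λ ()) , (λ ())
avoid-two (suc (suc _)) zero          = suc zero , (λ ()) , (λ ())
avoid-two (suc (suc _)) (suc _)       = zero , (λ ()) , (λ ())

infix 8 ∼_
infix 4 _⊨ˡ_ _∈ᶜ_ _∈ᶜ?_ _⊨ᶜ_ _⊨ᶜ?_ _⊨_

Literal : ℕ → Set
Literal k = Fin k × Bool

var : Literal k → Fin k
var = proj₁

∼_ : Literal k → Literal k
∼ (v , b) = v , not b

_⊨ˡ_ : Assignment k → Literal k → Set
a ⊨ˡ (v , b) = a v ≡ b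

-- A clause as the characteristic function of its literals: C v b ≡ true iff "v = b" is in C.
Clauseᶠ : ℕ → Set
Clauseᶠ k = Fin k → Bool → Bool

CNFᶠ : ℕ → Set
CNFᶠ k = List (Clauseᶠ k)

_∈ᶜ_ : Literal k → Clauseᶠ k → Set
(v , b) ∈ᶜ C = T (C v b)

_∈ᶜ?_ : (l : Literal k) → Decidable (l ∈ᶜ_)
((v , b) ∈ᶜ? C) = T? (C v b)

_⊨ᶜ_ : Assignment k → Clauseᶠ k → Set
a ⊨ᶜ C = ∃ λ v → (v , a v) ∈ᶜ C

_⊨_ : Assignment k → CNFᶠ k → Set
a ⊨ φ = All (a ⊨ᶜ_) φ

occurrences : Literal k → CNFᶠ k → ℕ
occurrences l φ = length (filter (l ∈ᶜ?_) φ)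

private
  variable
    a : Assignment k
    l l′ m : Literal k
    C : Clauseᶠ k
    φ : CNFᶠ k

_⊨ᶜ?_ : (a : Assignment k) → Decidable (a ⊨ᶜ_)
a ⊨ᶜ? C = any? λ v → (v , a v) ∈ᶜ? C

∈ᶜ⇒⊨ᶜ : a ⊨ˡ l → l ∈ᶜ C → a ⊨ᶜ C
∈ᶜ⇒⊨ᶜ {l = v , _} refl l∈C = v , l∈C

⊨ˡ-∼ : ¬ a ⊨ˡ l → a ⊨ˡ ∼ l
⊨ˡ-∼ = ¬-not

set : Literal k → Assignment k → Assignment k
set (v , b) a = updateAt a v (const b)

set-⊨ˡ : ∀ l → set l a ⊨ˡ l
set-⊨ˡ {a = a} (v , b) = updateAt-updates v a

set-≢ : ∀ {u} → u ≢ var l → set l a u ≡ a u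
set-≢ {l = v , _} {a = a} {u} u≢v = updateAt-minimal u v a u≢v

set-⊨ˡ-≢ : var m ≢ var l → a ⊨ˡ m → set l a ⊨ˡ m
set-⊨ˡ-≢ m≢l a⊨m = trans (set-≢ m≢l) a⊨m

set-⊨ᶜ : a ⊨ᶜ C → ¬ ∼ l ∈ᶜ C → set l a ⊨ᶜ C
set-⊨ᶜ {a = a} {C = C} {l = v , b} (u , u∈C) ∼l∉C with u Fin.≟ v
... | no u≢v = u , subst (λ x → (u , x) ∈ᶜ C) (sym (set-≢ u≢v)) u∈C
... | yes refl with a u Bool.≟ b
...   | yes au≡b = u , subst (λ x → (u , x) ∈ᶜ C) (trans au≡b (sym (set-⊨ˡ (u , b)))) u∈C
...   | no au≢b  = ⊥-elim (∼l∉C (subst (λ x → (u , x) ∈ᶜ C) (¬-not au≢b) u∈C))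

falsified-clause : a ⊨ φ → ¬ set l a ⊨ φ → Any (λ C → ¬ set l a ⊨ᶜ C) (filter (∼ l ∈ᶜ?_) φ)
falsified-clause {a = a} {φ = φ} {l = l} a⊨φ set⊭φ =
  ¬All⇒Any¬ (set l a ⊨ᶜ?_) _ λ set⊨∼l-clauses →
    set⊭φ (filter⁻ (∼ l ∈ᶜ?_) set⊨∼l-clauses
             (All.zipWith (λ {C} (a⊨C , ∼l∉C) → set-⊨ᶜ {C = C} {l = l} a⊨C ∼l∉C)
                          (filter⁺ _ a⊨φ , all-filter (∁? (∼ l ∈ᶜ?_)) φ)))

erase : Fin k → Clauseᶠ k → Clauseᶠ k
erase v C = updateAt C v (const (const false))

erase-≢ : ∀ {u v} → u ≢ v → erase v C u ≡ C u
erase-≢ {C = C} {u} {v} u≢v = updateAt-minimal u v C u≢v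

∈ᶜ-erase : ∀ {v} → var l ≢ v → l ∈ᶜ erase v C ⇔ l ∈ᶜ C
∈ᶜ-erase {l = w , b} w≢v = mk⇔ (subst T (cong (λ D → D b) (erase-≢ w≢v)))
                                (subst T (cong (λ D → D b) (sym (erase-≢ w≢v))))

⊨ᶜ-erase : a ⊨ˡ l → ¬ l ∈ᶜ C → a ⊨ᶜ C → a ⊨ᶜ erase (var l) C
⊨ᶜ-erase {a = a} {l = v , _} refl l∉C (u , u∈C) with u Fin.≟ v
... | yes refl = ⊥-elim (l∉C u∈C)
... | no u≢v   = u , subst (λ D → T (D (a u))) (sym (erase-≢ u≢v)) u∈C

⊨ᶜ-erase⁻ : ∀ {v} x → a ⊨ᶜ erase v C → set (v , x) a ⊨ᶜ C
⊨ᶜ-erase⁻ {a = a} {C = C} {v} x (u , u∈) with u Fin.≟ v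
... | yes refl = ⊥-elim (subst T (cong (λ D → D (a u)) (updateAt-updates u C)) u∈)
... | no u≢v   = u , subst (λ b → T (C u b)) (sym (set-≢ u≢v))
                           (subst (λ D → T (D (a u))) (erase-≢ u≢v) u∈)

-- transfer b c d is the value of v that makes "v = b ⇔ w = c" true when w has value d.
transfer : Bool → Bool → Bool → Bool
transfer b c d = b xor (c xor d)

transfer-≡ : ∀ b c → transfer b c c ≡ b
transfer-≡ false false = refl
transfer-≡ false true  = refl
transfer-≡ true  false = refl
transfer-≡ true  true  = refl

transfer-not : ∀ b c → transfer b c (not c) ≡ not b
transfer-not false false = refl
transfer-not false true  = refl
transfer-not true  false = refl
transfer-not true  true  = refl

Tied : Literal k → Literal k → Assignment k → Set
Tied (v , b) (w , c) a = a v ≡ transfer b c (a w)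

tie : Literal k → Literal k → Assignment k → Assignment k
tie (v , b) (w , c) a = set (v , transfer b c (a w)) a

tie-Tied : var m ≢ var l → Tied l m (tie l m a)
tie-Tied {m = w , c} {l = v , b} {a = a} w≢v =
  trans (set-⊨ˡ (v , transfer b c (a w))) (cong (transfer b c) (sym (set-≢ w≢v)))

⊨ˡ⇒Tied : a ⊨ˡ l → a ⊨ˡ m → Tied l m a
⊨ˡ⇒Tied {a = a} {l = v , _} {m = w , _} refl refl = sym (transfer-≡ (a v) (a w))

⊨ˡ∼⇒Tied : a ⊨ˡ ∼ l → a ⊨ˡ ∼ m → Tied l m a
⊨ˡ∼⇒Tied {l = _ , b} {m = _ , c} a⊨∼l a⊨∼m =
  trans a⊨∼l (sym (trans (cong (transfer b c) a⊨∼m) (transfer-not b c)))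

Tied-⊨ˡ : Tied l m a → a ⊨ˡ m → a ⊨ˡ l
Tied-⊨ˡ {l = _ , b} {m = w , _} {a = a} tied refl = trans tied (transfer-≡ b (a w))

Tied-⊨ᶜ : Tied l m a → ∼ l ∈ᶜ C → m ∈ᶜ C → a ⊨ᶜ C
Tied-⊨ᶜ {l = v , b} {m = w , c} {a = a} {C = C} tied ∼l∈C m∈C with a w Bool.≟ c
... | yes a⊨m = ∈ᶜ⇒⊨ᶜ {l = w , c} {C = C} a⊨m m∈C
... | no a⊭m  = ∈ᶜ⇒⊨ᶜ {l = v , not b} {C = C} a⊨∼l ∼l∈C
  where
  a⊨∼l : a v ≡ not b
  a⊨∼l = trans tied (trans (cong (transfer b c) (¬-not a⊭m)) (transfer-not b c))

tie-⊨ˡ-≢ : var l′ ≢ var l → a ⊨ˡ l′ → tie l m a ⊨ˡ l′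
tie-⊨ˡ-≢ {l′ = l′} {l = v , _} {m = w , _} = set-⊨ˡ-≢ {m = l′}

tie-⊨ˡ : var m ≢ var l → a ⊨ˡ m → tie l m a ⊨ˡ l
tie-⊨ˡ {m = m} {l = l} {a = a} m≢l a⊨m =
  Tied-⊨ˡ {l = l} {m = m} {a = tie l m a} (tie-Tied {m = m} {l = l} {a = a} m≢l)
          (tie-⊨ˡ-≢ {l′ = m} {l = l} {m = m} m≢l a⊨m)

-- merge l m C adds to C, for each literal over var l, the literal over var m that is equivalent
-- to it under l ⇔ m.
merge : Literal k → Literal k → Clauseᶠ k → Clauseᶠ k
merge (v , b) (w , c) C = updateAt C w (λ Cw d → Cw d ∨ C v (transfer b c d))

merge-≢ : ∀ (l m : Literal k) C {u} → u ≢ var m → merge l m C u ≡ C u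
merge-≢ (v , b) (w , _) C {u} u≢w = updateAt-minimal u w C u≢w

merge-at : ∀ (l m : Literal k) C d →
           merge l m C (var m) d ≡ (C (var m) d ∨ C (var l) (transfer (proj₂ l) (proj₂ m) d))
merge-at (v , b) (w , c) C d = cong (λ D → D d) (updateAt-updates w C)

⊨ᶜ-merge⁻ : Tied l m a → a ⊨ᶜ merge l m C → a ⊨ᶜ C
⊨ᶜ-merge⁻ {l = v , b} {m = w , c} {a = a} {C = C} tied (u , u∈) with u Fin.≟ w
... | no u≢w   = u , subst (λ D → T (D (a u))) (merge-≢ (v , b) (w , c) C u≢w) u∈
... | yes refl with Equivalence.to T-∨ (subst T (merge-at (v , b) (w , c) C (a u)) u∈)
...   | inj₁ u∈C = u , u∈C
...   | inj₂ v∈C = v , subst (λ x → T (C v x)) (sym tied) v∈C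

substitute : Literal k → Literal k → Clauseᶠ k → Clauseᶠ k
substitute l m = erase (var l) ∘ merge l m

substitute-at : ∀ (l m : Literal k) C → var m ≢ var l → ∀ d →
                substitute l m C (var m) d ≡ (C (var m) d ∨ C (var l) (transfer (proj₂ l) (proj₂ m) d))
substitute-at l m C m≢l d =
  trans (cong (λ D → D d) (erase-≢ {C = merge l m C} m≢l)) (merge-at l m C d)

substitute-≢ : ∀ (l m : Literal k) C {u} → u ≢ var l → u ≢ var m → substitute l m C u ≡ C u
substitute-≢ l m C u≢v u≢w = trans (erase-≢ {C = merge l m C} u≢v) (merge-≢ l m C u≢w)

⊨ᶜ-substitute : var m ≢ var l → Tied l m a → a ⊨ᶜ C → a ⊨ᶜ substitute l m C
⊨ᶜ-substitute {m = w , c} {l = v , b} {a = a} {C = C} w≢v tied (u , u∈C) with u Fin.≟ v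
... | yes refl = w , subst T (sym (substitute-at (v , b) (w , c) C w≢v (a w)))
                           (Equivalence.from T-∨ (inj₂ (subst (λ x → T (C u x)) tied u∈C)))
... | no u≢v with u Fin.≟ w
...   | yes refl = u , subst T (sym (substitute-at (v , b) (w , c) C (u≢v) (a u)))
                             (Equivalence.from T-∨ (inj₁ u∈C))
...   | no u≢w   = u , subst (λ D → T (D (a u))) (sym (substitute-≢ (v , b) (w , c) C u≢v u≢w)) u∈C

⊨ᶜ-substitute⁻ : var m ≢ var l → a ⊨ᶜ substitute l m C → tie l m a ⊨ᶜ C
⊨ᶜ-substitute⁻ {m = m} {l = l} {a = a} {C = C} m≢l =
  ⊨ᶜ-merge⁻ {l = l} {m = m} {C = C} (tie-Tied {m = m} {l = l} {a = a} m≢l)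
  ∘ ⊨ᶜ-erase⁻ {C = merge l m C} (transfer (proj₂ l) (proj₂ m) (a (var m)))

dropping : Literal k → (Clauseᶠ k → Clauseᶠ k) → CNFᶠ k → CNFᶠ k
dropping l f φ = map f (filter (∁? (l ∈ᶜ?_)) φ)

length-dropping : ∀ l f (φ : CNFᶠ k) → length (dropping l f φ) + occurrences l φ ≡ length φ
length-dropping l f φ = trans (cong (_+ occurrences l φ) (length-map f (filter (∁? (l ∈ᶜ?_)) φ)))
                              (length-filter-∁ (l ∈ᶜ?_) φ)

dropping-< : ∀ {f} → 0 < occurrences l φ → length (dropping l f φ) < length φ
dropping-< {l = l} {φ = φ} {f} 0<occ = begin-strict
  length (dropping l f φ)                     <⟨ m<m+n _ 0<occ ⟩
  length (dropping l f φ) + occurrences l φ   ≡⟨ length-dropping l f φ ⟩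
  length φ                                    ∎
  where open ≤-Reasoning

⊨-dropping : ∀ {f} → (∀ {C} → ¬ l ∈ᶜ C → a ⊨ᶜ C → a ⊨ᶜ f C) → a ⊨ φ → a ⊨ dropping l f φ
⊨-dropping {l = l} {φ = φ} f⁺ a⊨φ =
  map⁺ (All.zipWith (λ (l∉C , a⊨C) → f⁺ l∉C a⊨C) (all-filter (∁? (l ∈ᶜ?_)) φ , filter⁺ _ a⊨φ))

⊨-dropping⁻ : ∀ {a′ f} → All (a′ ⊨ᶜ_) (filter (l ∈ᶜ?_) φ) → (∀ {C} → a ⊨ᶜ f C → a′ ⊨ᶜ C) →
              a ⊨ dropping l f φ → a′ ⊨ φ
⊨-dropping⁻ {l = l} a′⊨l-clauses f⁻ a⊨ = filter⁻ (l ∈ᶜ?_) a′⊨l-clauses (All.map f⁻ (map⁻ a⊨))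

restrict : Literal k → CNFᶠ k → CNFᶠ k
restrict l = dropping l (erase (var l))

⊨-restrict : a ⊨ˡ l → a ⊨ φ → a ⊨ restrict l φ
⊨-restrict a⊨l = ⊨-dropping λ {C} → ⊨ᶜ-erase {C = C} a⊨l

⊨-restrict⁻ : a ⊨ restrict l φ → set l a ⊨ φ
⊨-restrict⁻ {a = a} {l = l} {φ = φ} =
  ⊨-dropping⁻ (All.map (λ {C} → ∈ᶜ⇒⊨ᶜ {C = C} (set-⊨ˡ {a = a} l)) (all-filter (l ∈ᶜ?_) φ))
              (λ {C} → ⊨ᶜ-erase⁻ {C = C} (proj₂ l))

occurrences-restrict : var m ≢ var l →
  occurrences m (restrict l φ) ≡ length (filter (m ∈ᶜ?_) (filter (∁? (l ∈ᶜ?_)) φ))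
occurrences-restrict {m = m} {l = l} {φ = φ} m≢l =
  length-filter-map (m ∈ᶜ?_) (erase (var l)) (m ∈ᶜ?_) (λ {C} → ∈ᶜ-erase {l = m} {C = C} m≢l)
                    (filter (∁? (l ∈ᶜ?_)) φ)

replace : Literal k → Literal k → CNFᶠ k → CNFᶠ k
replace l m = dropping (∼ l) (substitute l m)

-- Stated for literals rather than input variables, since the substitution step may replace a
-- literal by one over an auxiliary variable.
record IsPEncoding (ls : Fin n → Literal k) (φ : CNFᶠ k) : Set where
  field
    satisfiable : ∀ i → ∃ λ a → a ⊨ φ × a ⊨ˡ ls i
    at-most-one : ∀ {i j} → i ≢ j → ∀ {a} → a ⊨ φ → a ⊨ˡ ls i → a ⊨ˡ ls j → ⊥

  witness : Fin n → Assignment k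
  witness i = proj₁ (satisfiable i)

  witness-⊨ : ∀ i → witness i ⊨ φ
  witness-⊨ i = proj₁ (proj₂ (satisfiable i))

  witness-⊨ˡ : ∀ i → witness i ⊨ˡ ls i
  witness-⊨ˡ i = proj₂ (proj₂ (satisfiable i))

  witness-⊨ˡ∼ : ∀ {i j} → i ≢ j → witness j ⊨ˡ ∼ ls i
  witness-⊨ˡ∼ {i} {j} i≢j = ⊨ˡ-∼ {a = witness j} {l = ls i} λ wⱼ⊨lᵢ →
    at-most-one i≢j (witness-⊨ j) wⱼ⊨lᵢ (witness-⊨ˡ j)

vars-distinct : ∀ {ls : Fin (3 + n) → Literal k} → IsPEncoding ls φ →
                ∀ {i j} → i ≢ j → var (ls i) ≢ var (ls j)
vars-distinct {ls = ls} E {i} {j} i≢j vᵢ≡vⱼ = at-most-one i≢j (witness-⊨ i) (witness-⊨ˡ i) wᵢ⊨lⱼ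
  where
  open IsPEncoding E
  t = proj₁ (avoid-two i j)
  t≢i = proj₁ (proj₂ (avoid-two i j))
  t≢j = proj₂ (proj₂ (avoid-two i j))
  bᵢ≡bⱼ : proj₂ (ls i) ≡ proj₂ (ls j)
  bᵢ≡bⱼ = not-injective (trans (sym (witness-⊨ˡ∼ (t≢i ∘ sym)))
                               (trans (cong (witness t) vᵢ≡vⱼ) (witness-⊨ˡ∼ (t≢j ∘ sym))))
  wᵢ⊨lⱼ : witness i ⊨ˡ ls j
  wᵢ⊨lⱼ = trans (cong (witness i) (sym vᵢ≡vⱼ)) (trans (witness-⊨ˡ i) bᵢ≡bⱼ)

module Reductions {ls : Fin (suc n) → Literal k} {φ : CNFᶠ k} (E : IsPEncoding ls φ)
                  (distinct : ∀ {i j} → i ≢ j → var (ls i) ≢ var (ls j)) where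
  open IsPEncoding E

  falsified-by-swap : ∀ {i j} → j ≢ i →
                      Any (λ C → ¬ set (ls i) (witness j) ⊨ᶜ C) (filter (∼ ls i ∈ᶜ?_) φ)
  falsified-by-swap {i} {j} j≢i = falsified-clause (witness-⊨ j) λ swap⊨φ →
    at-most-one (j≢i ∘ sym) swap⊨φ (set-⊨ˡ (ls i)) (set-⊨ˡ-≢ {m = ls j} (distinct j≢i) (witness-⊨ˡ j))

  restrict-encoding : ∀ i → IsPEncoding (ls ∘ punchIn i) (restrict (∼ ls i) φ)
  restrict-encoding i = record { satisfiable = satisfiable′ ; at-most-one = at-most-one′ }
    where
    satisfiable′ : ∀ p → ∃ λ a → a ⊨ restrict (∼ ls i) φ × a ⊨ˡ ls (punchIn i p)
    satisfiable′ p = witness (punchIn i p)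
                   , ⊨-restrict (witness-⊨ˡ∼ (punchInᵢ≢i i p ∘ sym)) (witness-⊨ (punchIn i p))
                   , witness-⊨ˡ (punchIn i p)
    lift : ∀ {a} p → a ⊨ˡ ls (punchIn i p) → set (∼ ls i) a ⊨ˡ ls (punchIn i p)
    lift p = set-⊨ˡ-≢ (distinct (punchInᵢ≢i i p))
    at-most-one′ : ∀ {p q} → p ≢ q → ∀ {a} → a ⊨ restrict (∼ ls i) φ →
                   a ⊨ˡ ls (punchIn i p) → a ⊨ˡ ls (punchIn i q) → ⊥
    at-most-one′ {p} {q} p≢q a⊨ a⊨lp a⊨lq =
      at-most-one (p≢q ∘ punchIn-injective i p q) (⊨-restrict⁻ a⊨) (lift p a⊨lp) (lift q a⊨lq)

  replace-encoding : ∀ i {m} → var m ≢ var (ls i) → All (m ∈ᶜ_) (filter (∼ ls i ∈ᶜ?_) φ) →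
                     witness i ⊨ˡ m → (∀ {j} → j ≢ i → witness j ⊨ˡ ∼ m) →
                     IsPEncoding (updateAt ls i (const m)) (replace (ls i) m φ)
  replace-encoding i {m} m≢lᵢ m∈ wᵢ⊨m wⱼ⊨∼m =
    record { satisfiable = satisfiable′ ; at-most-one = at-most-one′ }
    where
    lᵢ = ls i
    ls′ = updateAt ls i (const m)

    witness-Tied : ∀ p → Tied lᵢ m (witness p) × witness p ⊨ˡ ls′ p
    witness-Tied p with p Fin.≟ i
    ... | yes refl = ⊨ˡ⇒Tied {l = lᵢ} {m = m} (witness-⊨ˡ i) wᵢ⊨m
                   , subst (witness i ⊨ˡ_) (sym (updateAt-updates i ls)) wᵢ⊨m
    ... | no p≢i   = ⊨ˡ∼⇒Tied {l = lᵢ} {m = m} (witness-⊨ˡ∼ (p≢i ∘ sym)) (wⱼ⊨∼m p≢i)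
                   , subst (witness p ⊨ˡ_) (sym (updateAt-minimal p i ls p≢i)) (witness-⊨ˡ p)

    satisfiable′ : ∀ p → ∃ λ a → a ⊨ replace lᵢ m φ × a ⊨ˡ ls′ p
    satisfiable′ p =
      witness p ,
      ⊨-dropping (λ {C} _ → ⊨ᶜ-substitute {m = m} {l = lᵢ} {C = C} m≢lᵢ (proj₁ (witness-Tied p)))
                 (witness-⊨ p) ,
      proj₂ (witness-Tied p)

    at-most-one′ : ∀ {p q} → p ≢ q → ∀ {a} → a ⊨ replace lᵢ m φ → a ⊨ˡ ls′ p → a ⊨ˡ ls′ q → ⊥
    at-most-one′ {p} {q} p≢q {a} a⊨ a⊨l′p a⊨l′q =
      at-most-one p≢q tie⊨φ (lift p a⊨l′p) (lift q a⊨l′q)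
      where
      tied : Tied lᵢ m (tie lᵢ m a)
      tied = tie-Tied {m = m} {l = lᵢ} {a = a} m≢lᵢ
      tie⊨φ : tie lᵢ m a ⊨ φ
      tie⊨φ = ⊨-dropping⁻ (All.zipWith (λ {C} (∼lᵢ∈C , m∈C) → Tied-⊨ᶜ {C = C} tied ∼lᵢ∈C m∈C)
                                        (all-filter _ φ , m∈))
                          (λ {C} → ⊨ᶜ-substitute⁻ {m = m} {l = lᵢ} {C = C} m≢lᵢ) a⊨
      lift : ∀ r → a ⊨ˡ ls′ r → tie lᵢ m a ⊨ˡ ls r
      lift r a⊨l′ᵣ with r Fin.≟ i
      ... | yes refl = tie-⊨ˡ {l = lᵢ} m≢lᵢ (subst (a ⊨ˡ_) (updateAt-updates i ls) a⊨l′ᵣ)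
      ... | no r≢i   = tie-⊨ˡ-≢ {l = lᵢ} {m = m} (distinct r≢i)
                                 (subst (a ⊨ˡ_) (updateAt-minimal r i ls r≢i) a⊨l′ᵣ)

  -- m₀ is the literal through which the witness of l_i satisfies P, the only clause containing
  -- ∼ l_i. Making l_i true in any other witness falsifies P, hence m₀.
  eliminate-unit : ∀ {i j} → j ≢ i → occurrences (∼ ls i) φ ≡ 1 →
                   ∃₂ λ (ls′ : Fin (suc n) → Literal k) ψ → length ψ < length φ × IsPEncoding ls′ ψ
  eliminate-unit {i} {j} j≢i occ≡1 with length≡1⇒singleton _ occ≡1
  ... | P , only-P = updateAt ls i (const m₀) , replace lᵢ m₀ φ
                   , dropping-< {l = ∼ lᵢ} {φ = φ} {f = substitute lᵢ m₀} (≤-reflexive (sym occ≡1))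
                   , replace-encoding i m₀≢lᵢ m₀∈∼lᵢ-clauses refl wⱼ⊨∼m₀
    where
    lᵢ = ls i
    P∈φ : P ∈ φ
    P∈φ = proj₁ (∈-filter⁻ (∼ lᵢ ∈ᶜ?_) (subst (P ∈_) (sym only-P) (here refl)))
    w = proj₁ (All.lookup (witness-⊨ i) P∈φ)
    m₀ = w , witness i w
    m₀∈P : m₀ ∈ᶜ P
    m₀∈P = proj₂ (All.lookup (witness-⊨ i) P∈φ)
    swap⊭P : ∀ {j} → j ≢ i → ¬ set lᵢ (witness j) ⊨ᶜ P
    swap⊭P j≢i with subst (Any _) only-P (falsified-by-swap j≢i)
    ... | here swap⊭P = swap⊭P
    swap⊭m₀ : ∀ {j} → j ≢ i → ¬ set lᵢ (witness j) ⊨ˡ m₀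
    swap⊭m₀ {j} j≢i swap⊨m₀ =
      swap⊭P j≢i (∈ᶜ⇒⊨ᶜ {a = set lᵢ (witness j)} {l = m₀} {C = P} swap⊨m₀ m₀∈P)
    m₀≢lᵢ : w ≢ var lᵢ
    m₀≢lᵢ w≡v = swap⊭m₀ j≢i (subst (λ u → set lᵢ (witness j) u ≡ witness i u) (sym w≡v)
                                 (trans (set-⊨ˡ lᵢ) (sym (witness-⊨ˡ i))))
    wⱼ⊨∼m₀ : ∀ {j} → j ≢ i → witness j ⊨ˡ ∼ m₀
    wⱼ⊨∼m₀ {j} j≢i = ⊨ˡ-∼ {a = witness j} {l = m₀}
                      (swap⊭m₀ j≢i ∘ set-⊨ˡ-≢ {m = m₀} {l = lᵢ} {a = witness j} m₀≢lᵢ)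
    m₀∈∼lᵢ-clauses : All (m₀ ∈ᶜ_) (filter (∼ lᵢ ∈ᶜ?_) φ)
    m₀∈∼lᵢ-clauses = subst (All (m₀ ∈ᶜ_)) (sym only-P) (m₀∈P ∷ [])

module Reductions₃ {k n} {ls : Fin (3 + n) → Literal k} {φ : CNFᶠ k} (E : IsPEncoding ls φ) =
  Reductions E (vars-distinct E)

∼-occurs : ∀ {ls : Fin (3 + n) → Literal k} → IsPEncoding ls φ → ∀ i → 0 < occurrences (∼ ls i) φ
∼-occurs E i = Any⇒0<length (Reductions₃.falsified-by-swap E (proj₁ (proj₂ (avoid-two i i))))

BoundHoldsBelow : ℕ → ℕ → Set
BoundHoldsBelow k L = ∀ {n} {ls : Fin (3 + n) → Literal k} {ψ} →
                      length ψ < L → IsPEncoding ls ψ → bound (3 + n) ≤ length ψ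

unit-case : ∀ {ls : Fin (3 + n) → Literal k} → IsPEncoding ls φ → BoundHoldsBelow k (length φ) →
            ∀ i → occurrences (∼ ls i) φ ≡ 1 → bound (3 + n) < length φ
unit-case E IH i occ≡1 with Reductions₃.eliminate-unit E (proj₁ (proj₂ (avoid-two i i))) occ≡1
... | _ , _ , ψ<φ , E′ = ≤-<-trans (IH ψ<φ E′) ψ<φ

base-case : ∀ {ls : Fin 3 → Literal k} → IsPEncoding ls φ → 2 ≤ occurrences (∼ ls zero) φ → 3 ≤ length φ
base-case {φ = φ} {ls = ls} E 2≤occ =
  ≤-trans (s≤s 2≤occ) (filter-notAll (∼ ls zero ∈ᶜ?_) φ clause-without-∼l₀)
  where
  open IsPEncoding E
  swap⊨∼l₀ : set (ls (suc zero)) (witness (suc (suc zero))) ⊨ˡ ∼ ls zero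
  swap⊨∼l₀ = set-⊨ˡ-≢ {m = ∼ ls zero} {l = ls (suc zero)} (vars-distinct E (λ ())) (witness-⊨ˡ∼ (λ ()))
  clause-without-∼l₀ : Any (λ C → ¬ ∼ ls zero ∈ᶜ C) φ
  clause-without-∼l₀ = Any.map (λ {C} swap⊭C → swap⊭C ∘ ∈ᶜ⇒⊨ᶜ {C = C} swap⊨∼l₀)
                         (Any-filter⁻ (∼ ls (suc zero) ∈ᶜ?_)
                           (Reductions₃.falsified-by-swap E {suc zero} {suc (suc zero)} (λ ())))

restrict-case : ∀ {ls : Fin (4 + n) → Literal k} → IsPEncoding ls φ → BoundHoldsBelow k (length φ) →
                ∀ i → 3 ≤ occurrences (∼ ls i) φ → bound (4 + n) ≤ length φ
restrict-case {n = n} {φ = φ} {ls = ls} E IH i 3≤occ = begin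
  bound (4 + n)                                ≤⟨ bound-suc (3 + n) ⟩
  bound (3 + n) + 3                            ≤⟨ +-mono-≤ (IH shorter E′) 3≤occ ⟩
  length φ′ + occurrences (∼ ls i) φ           ≡⟨ length-dropping (∼ ls i) _ φ ⟩
  length φ                                     ∎
  where
  open ≤-Reasoning
  φ′ = restrict (∼ ls i) φ
  E′ = Reductions₃.restrict-encoding E i
  shorter : length φ′ < length φ
  shorter = dropping-< {l = ∼ ls i} {φ = φ} (≤-trans (s≤s z≤n) 3≤occ)

overlap-case : ∀ {ls : Fin (4 + n) → Literal k} → IsPEncoding ls φ → BoundHoldsBelow k (length φ) →
               ∀ {i j} → i ≢ j → Any (λ C → ∼ ls j ∈ᶜ C × ∼ ls i ∈ᶜ C) φ →
               2 ≤ occurrences (∼ ls i) φ → occurrences (∼ ls j) φ ≤ 2 → bound (4 + n) ≤ length φ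
overlap-case {n = n} {φ = φ} {ls = ls} E IH {i} {j} i≢j both 2≤occᵢ occⱼ≤2 = begin
  bound (4 + n)                                ≤⟨ bound-suc (3 + n) ⟩
  bound (3 + n) + 3                            ≡⟨ +-suc (bound (3 + n)) 2 ⟩
  suc (bound (3 + n)) + 2                      ≤⟨ +-mono-≤ (unit-case E′ IH′ j′ occ′≡1) 2≤occᵢ ⟩
  length φ′ + occurrences (∼ ls i) φ           ≡⟨ length-dropping (∼ ls i) _ φ ⟩
  length φ                                     ∎
  where
  open ≤-Reasoning
  φ′ = restrict (∼ ls i) φ
  E′ = Reductions₃.restrict-encoding E i
  shorter : length φ′ < length φ
  shorter = dropping-< {l = ∼ ls i} {φ = φ} (≤-trans (s≤s z≤n) 2≤occᵢ)
  IH′ : BoundHoldsBelow _ (length φ′)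
  IH′ ψ<φ′ = IH (<-trans ψ<φ′ shorter)
  j′ = punchOut i≢j
  occ′<occ : occurrences (∼ ls j) φ′ < occurrences (∼ ls j) φ
  occ′<occ = subst (_< occurrences (∼ ls j) φ)
                   (sym (occurrences-restrict {m = ∼ ls j} {l = ∼ ls i} {φ = φ}
                                              (vars-distinct E (i≢j ∘ sym))))
                   (length-filter-filter-∁< (∼ ls j ∈ᶜ?_) (∼ ls i ∈ᶜ?_) both)
  occ′≡1 : occurrences (∼ ls (punchIn i j′)) φ′ ≡ 1
  occ′≡1 = ≤-antisym (subst (λ t → occurrences (∼ ls t) φ′ ≤ 1) (sym (punchIn-punchOut i≢j))
                            (≤-pred (≤-trans occ′<occ occⱼ≤2)))
                     (∼-occurs E′ j′)

repeated-case : ∀ {ls : Fin (3 + n) → Literal k} → IsPEncoding ls φ → BoundHoldsBelow k (length φ) →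
                (∀ i → 2 ≤ occurrences (∼ ls i) φ) → bound (3 + n) ≤ length φ
repeated-case {n = zero} E IH 2≤occ = base-case E (2≤occ zero)
repeated-case {n = suc n} {φ = φ} {ls = ls} E IH 2≤occ with any? (λ i → 3 ≤? occurrences (∼ ls i) φ)
... | yes (i , 3≤occ) = restrict-case E IH i 3≤occ
... | no ¬3≤occ with ∑-length-filter≤length⊎overlap (λ i → ∼ ls i ∈ᶜ?_) φ
...   | inj₂ (i , j , i≢j , both) =
        overlap-case E IH (i≢j ∘ sym) both (2≤occ j) (≤-pred (≰⇒> (¬3≤occ ∘ (i ,_))))
...   | inj₁ ∑≤length = begin
  bound (4 + n)                                ≤⟨ bound≤2* (4 + n) ⟩
  2 * (4 + n)                                  ≡⟨ *-comm 2 (4 + n) ⟩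
  (4 + n) * 2                                  ≤⟨ *≤∑ (λ i → occurrences (∼ ls i) φ) 2≤occ ⟩
  ∑[ i < 4 + n ] occurrences (∼ ls i) φ        ≤⟨ ∑≤length ⟩
  length φ                                     ∎
  where open ≤-Reasoning

bound≤length-step : ∀ {ls : Fin (3 + n) → Literal k} → IsPEncoding ls φ → BoundHoldsBelow k (length φ) →
                    bound (3 + n) ≤ length φ
bound≤length-step {φ = φ} {ls = ls} E IH with any? (λ i → occurrences (∼ ls i) φ ≟ 1)
... | yes (i , occ≡1) = <⇒≤ (unit-case E IH i occ≡1)
... | no ¬occ≡1       = repeated-case E IH λ i → ≤∧≢⇒< (∼-occurs E i) (¬occ≡1 ∘ (i ,_) ∘ sym)

bound≤length : ∀ {ls : Fin (3 + n) → Literal k} → Acc _<_ (length φ) → IsPEncoding ls φ →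
               bound (3 + n) ≤ length φ
bound≤length (acc rec) E = bound≤length-step E λ ψ<φ → bound≤length (rec ψ<φ)

toClauseᶠ : Clause k → Clauseᶠ k
toClauseᶠ C v true  = Vec.lookup (pos C) v
toClauseᶠ C v false = Vec.lookup (neg C) v

SatClause⇒⊨ᶜ : ∀ {C} → SatClause a C → a ⊨ᶜ toClauseᶠ C
SatClause⇒⊨ᶜ {C = C} (v , inj₁ (v∈pos , av≡true)) =
  v , subst (λ b → T (toClauseᶠ C v b)) (sym av≡true) (Equivalence.from T-≡ ([]=⇒lookup v∈pos))
SatClause⇒⊨ᶜ {C = C} (v , inj₂ (v∈neg , av≡false)) =
  v , subst (λ b → T (toClauseᶠ C v b)) (sym av≡false) (Equivalence.from T-≡ ([]=⇒lookup v∈neg))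

⊨ᶜ⇒SatClause : ∀ {C} → a ⊨ᶜ toClauseᶠ C → SatClause a C
⊨ᶜ⇒SatClause {a = a} {C} (v , v∈C) with a v in av≡
... | true  = v , inj₁ (lookup⇒[]= v (pos C) (Equivalence.to T-≡ v∈C) , av≡)
... | false = v , inj₂ (lookup⇒[]= v (neg C) (Equivalence.to T-≡ v∈C) , av≡)

lemma20 : (n m : ℕ) → 3 ≤ n → (φ : CNF (n + m)) → Unique φ →
    IsGenPEncoding n m φ → (2 * n) ⊓ (3 * n ∸ 6) ≤ length φ
lemma20 (suc (suc (suc n))) m (s≤s (s≤s (s≤s _))) φ _ enc =
  subst (bound (3 + n) ≤_) (length-map toClauseᶠ φ) (bound≤length (<-wellFounded _) encoding)
  where
  open IsGenPEncoding enc
  encoding : IsPEncoding (λ i → inp m i , true) (map toClauseᶠ φ)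
  encoding = record
    { satisfiable = λ i → let a , a⊨φ , a⊨xᵢ = sat-xi i in
                          a , map⁺ (All.map SatClause⇒⊨ᶜ a⊨φ) , a⊨xᵢ
    ; at-most-one = λ {i} {j} i≢j {a} a⊨φ a⊨xᵢ a⊨xⱼ →
        [ not-¬ a⊨xᵢ , not-¬ a⊨xⱼ ]′ (amo i j i≢j a (All.map ⊨ᶜ⇒SatClause (map⁻ a⊨φ)))
    }
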